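{- Let $A=(Q,R,F)$ be an RNNA, and let $c\colon Q\to\mathcal{P}_{\mathsf{ufs}}(1+\mathbb{A}\times Q+[\mathbb{A}]Q)$ be the equivariant map with $\ast\in c(q)$ iff $q\in F$, $(a,q')\in c(q)$ iff $q\xrightarrow{a}q'$, and $\langle a\rangle q'\in c(q)$ iff $q\xrightarrow{|a}q'$. Let $\bar F$ be the extension of $FX=1+\mathbb{A}\times X+[\mathbb{A}]X$ to $\mathsf{Kl}(\mathcal{P}_{\mathsf{ufs}})$ given on $f\colon X\to\mathcal{P}_{\mathsf{ufs}}Y$ by $\bar Ff(\ast)=\{\ast\}$, $\bar Ff(a,x)=\{(a,y):y\in f(x)\}$, $\bar Ff(\langle a\rangle x)=\{\langle a\rangle y:y\in f(x)\}$, and let $J\iota^{ -1}\colon\bar{\mathbb{A}}^*/{=_\alpha}\to\mathcal{P}_{\mathsf{ufs}}F(\bar{\mathbb{A}}^*/{=_\alpha})$ send $[\varepsilon]_\alpha\mapsto\{\ast\}$, $[av]_\alpha\mapsto\{(a,[v]_\alpha)\}$, $[{|}a\,v]_\alpha\mapsto\{\langle a\rangle[v]_\alpha\}$. Then there is a unique equivariant map $\mathsf{tr}_c\colon Q\to\mathcal{P}_{\mathsf{ufs}}(\bar{\mathbb{A}}^*/{=_\alpha})$ with $J\iota^{ -1}\bullet\mathsf{tr}_c=\bar F\mathsf{tr}_c\bullet c$ (the coalgebraic trace map), and for every $q\in Q$, $\mathsf{tr}_c(q)$ is the bar language accepted by $q$.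
   Context: Fix a countably infinite set $\mathbb{A}$ of names; a nominal set is a set with an action of the finite permutations of $\mathbb{A}$ in which every element $x$ has a finite support with least support $\mathrm{supp}(x)$; orbit-finite means finitely many orbits. $\mathcal{P}_{\mathsf{ufs}}X$ is the nominal set of uniformly finitely supported subsets ($S$ with $\bigcup_{x\in S}\mathrm{supp}(x)$ finite). $[\mathbb{A}]X$ is the quotient of $\mathbb{A}\times X$ by $(a,x)\sim(b,y)$ iff $(a\,c)\cdot x=(b\,c)\cdot y$ for some (equivalently all) fresh $c$, classes $\langle a\rangle x$. Bar strings are words over $\bar{\mathbb{A}}=\mathbb{A}\cup\{{|}a:a\in\mathbb{A}\}$; $=_\alpha$ is the least equivalence with $x\,{|}a\,v=_\alpha x\,{|}b\,w$ whenever $\langle a\rangle v=\langle b\rangle w$; $[w]_\alpha$ is the class. An RNNA $(Q,R,F)$ consists of an orbit-finite nominal set $Q$, an equivariant $R\subseteq Q\times\bar{\mathbb{A}}\times Q$ (write $q\xrightarrow{\sigma}q'$) and an equivariant $F\subseteq Q$, such that (a) if $q\xrightarrow{|a}q'$ and $\langle a\rangle q'=\langle b\rangle q''$ then $q\xrightarrow{|b}q''$, and (b) for every $q$ the sets $\{(a,q'):q\xrightarrow{a}q'\}$ and $\{\langle a\rangle q':q\xrightarrow{|a}q'\}$ are finite. A state $q$ accepts a bar string $w=\sigma_1\cdots\sigma_n$ if there is a run $q\xrightarrow{\sigma_1}q_1\cdots\xrightarrow{\sigma_n}q_n$ with $q_n\in F$; the bar language accepted by $q$ is $\{[w]_\alpha: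 q\text{ accepts }w\}$. Kleisli composition is $(g\bullet f)(x)=\bigcup_{y\in f(x)}g(y)$; $1=\{\ast\}$. -}

module Defs where

open import Data.Nat using (ℕ; _≟_)
open import Data.Bool using (if_then_else_)
open import Data.Product using (Σ; ∃; _×_; _,_)
open import Data.Unit using (⊤)
open import Data.Empty using (⊥)
open import Data.List using (List; []; _∷_; _++_; map)
open import Data.List.Membership.Propositional using (_∈_)
open import Data.List.Relation.Unary.Any using (Any)
open import Relation.Nullary using (¬_)
open import Relation.Nullary.Decidable using (⌊_⌋)
open import Relation.Binary.PropositionalEquality using (_≡_; _≢_)
open import Relation.Binary.Structures using (IsEquivalence)
open import Function.Bundles using (_⇔_)

𝔸 : Set
𝔸 = ℕ

swapName : 𝔸 → 𝔸 → 𝔸 → 𝔸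
swapName a b c = if ⌊ c ≟ a ⌋ then b else (if ⌊ c ≟ b ⌋ then a else c)

-- Finite permutations, presented as finite products of transpositions
-- (every finite permutation is of this form); (a , b) ∷ π denotes (a b) ∘ π.
Perm : Set
Perm = List (𝔸 × 𝔸)

perm : Perm → 𝔸 → 𝔸
perm [] c = c
perm ((a , b) ∷ π) c = swapName a b (perm π c)

tr₂ : 𝔸 → 𝔸 → Perm
tr₂ a c = (a , c) ∷ []

-- Sets with a permutation action, up to a setoid equality (quotients are
-- represented by the carrier of representatives plus an equivalence).

record Act : Set₁ where
  field
    Carrier : Set
    _≈_     : Carrier → Carrier → Set
    act     : Perm → Carrier → Carrier
open Act public

Supports : (X : Act) → List 𝔸 → Carrier X → Set
Supports X S x = ∀ (π : Perm) → (∀ a → a ∈ S → perm π a ≡ a) → _≈_ X (act X π x) x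

_#[_]_ : 𝔸 → (X : Act) → Carrier X → Set
c #[ X ] x = Σ (List 𝔸) λ S → Supports X S x × ¬ (c ∈ S)

record IsNominal (X : Act) : Set where
  field
    isEquiv  : IsEquivalence (_≈_ X)
    act-resp : ∀ π {x y} → _≈_ X x y → _≈_ X (act X π x) (act X π y)
    act-id   : ∀ x → _≈_ X (act X [] x) x
    act-comp : ∀ π σ x → _≈_ X (act X (π ++ σ) x) (act X π (act X σ x))
    act-ext  : ∀ π σ x → (∀ a → perm π a ≡ perm σ a) → _≈_ X (act X π x) (act X σ x)
    finSupp  : ∀ x → Σ (List 𝔸) λ S → Supports X S x

OrbitFinite : Act → Set
OrbitFinite X = Σ (List (Carrier X)) λ reps →
  ∀ x → Any (λ y → Σ Perm λ π → _≈_ X x (act X π y)) reps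

-- Equality in [𝔸]X:  ⟨a⟩x = ⟨b⟩y  iff  (a c)·x = (b c)·y for some fresh c.
AbsEq : (X : Act) → 𝔸 → Carrier X → 𝔸 → Carrier X → Set
AbsEq X a x b y = Σ 𝔸 λ c →
  (c ≢ a × c ≢ b × c #[ X ] x × c #[ X ] y) ×
  _≈_ X (act X (tr₂ a c) x) (act X (tr₂ b c) y)

data FCar (C : Set) : Set where
  star : FCar C
  pl   : 𝔸 → C → FCar C
  ab   : 𝔸 → C → FCar C

FEq : (X : Act) → FCar (Carrier X) → FCar (Carrier X) → Set
FEq X star     star     = ⊤
FEq X (pl a x) (pl b y) = a ≡ b × _≈_ X x y
FEq X (ab a x) (ab b y) = AbsEq X a x b y
FEq X _        _        = ⊥

data BarLetter : Set where
  plain : 𝔸 → BarLetter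
  bar   : 𝔸 → BarLetter

actLetter : Perm → BarLetter → BarLetter
actLetter π (plain a) = plain (perm π a)
actLetter π (bar a)   = bar (perm π a)

BarString : Set
BarString = List BarLetter

actBS : Perm → BarString → BarString
actBS π = map (actLetter π)

Words : Act
Words = record { Carrier = BarString ; _≈_ = _≡_ ; act = actBS }

data _=α_ : BarString → BarString → Set where
  α-refl  : ∀ {v} → v =α v
  α-sym   : ∀ {v w} → v =α w → w =α v
  α-trans : ∀ {u v w} → u =α v → v =α w → u =α w
  α-step  : ∀ x a b v w → AbsEq Words a v b w →
            (x ++ bar a ∷ v) =α (x ++ bar b ∷ w)

BarLang : Act
BarLang = record { Carrier = BarString ; _≈_ = _=α_ ; act = actBS }

record RNNA : Set₁ where
  field
    Q        : Act
    Q-nom    : IsNominal Q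
    Q-of     : OrbitFinite Q
    R        : Carrier Q → BarLetter → Carrier Q → Set
    Fs       : Carrier Q → Set
    R-equiv  : ∀ π q σ q' → R q σ q' → R (act Q π q) (actLetter π σ) (act Q π q')
    R-resp   : ∀ {q₁ q₂ σ q₁' q₂'} → _≈_ Q q₁ q₂ → _≈_ Q q₁' q₂' → R q₁ σ q₁' → R q₂ σ q₂'
    F-equiv  : ∀ π q → Fs q → Fs (act Q π q)
    F-resp   : ∀ {q₁ q₂} → _≈_ Q q₁ q₂ → Fs q₁ → Fs q₂
    alphaInv : ∀ q a q' b q'' → R q (bar a) q' → AbsEq Q a q' b q'' → R q (bar b) q''
    finFree  : ∀ q → Σ (List (𝔸 × Carrier Q)) λ L →
                 (∀ {a q'} → (a , q') ∈ L → R q (plain a) q') ×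
                 (∀ a q' → R q (plain a) q' →
                   Any (λ p → FEq Q (pl a q') (pl (Data.Product.proj₁ p) (Data.Product.proj₂ p))) L)
    finBound : ∀ q → Σ (List (𝔸 × Carrier Q)) λ L →
                 (∀ {a q'} → (a , q') ∈ L → R q (bar a) q') ×
                 (∀ a q' → R q (bar a) q' →
                   Any (λ p → AbsEq Q a q' (Data.Product.proj₁ p) (Data.Product.proj₂ p)) L)
open RNNA public

module _ (A : RNNA) where
  private
    QA = Q A

  data Accepts : Carrier QA → BarString → Set where
    done : ∀ {q} → Fs A q → Accepts q []
    step : ∀ {q σ q' w} → R A q σ q' → Accepts q' w → Accepts q (σ ∷ w)

  InBarLang : Carrier QA → BarString → Set
  InBarLang q v = Σ BarString λ w → Accepts q w × (w =α v)

  -- The coalgebra c : Q → P_ufs(F Q), as a membership predicate.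
  cMem : Carrier QA → FCar (Carrier QA) → Set
  cMem q star      = Fs A q
  cMem q (pl a q') = R A q (plain a) q'
  cMem q (ab a q') = R A q (bar a) q'

  -- Maps Q → P(𝔸̄*/=α), given by membership predicates.
  QMap : Set₁
  QMap = Carrier QA → BarString → Set

  record IsEquivUfsMap (t : QMap) : Set where
    field
      resp-α : ∀ q {v w} → v =α w → t q v → t q w
      resp-Q : ∀ {q q'} → _≈_ QA q q' → ∀ v → t q v → t q' v
      ufs    : ∀ q → Σ (List 𝔸) λ S → ∀ v → t q v → Supports BarLang S v
      equiv  : ∀ π q v → t (act QA π q) v ⇔ (Σ BarString λ w → t q w × (v =α actBS π w))

  Jι⁻¹ : BarString → FCar BarString → Set
  Jι⁻¹ []            z = FEq BarLang z star
  Jι⁻¹ (plain a ∷ v) z = FEq BarLang z (pl a v)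
  Jι⁻¹ (bar a ∷ v)   z = FEq BarLang z (ab a v)

  Fbar : QMap → FCar (Carrier QA) → FCar BarString → Set
  Fbar t star      z = FEq BarLang z star
  Fbar t (pl a q') z = Σ BarString λ v → t q' v × FEq BarLang z (pl a v)
  Fbar t (ab a q') z = Σ BarString λ v → t q' v × FEq BarLang z (ab a v)

  -- Kleisli composites  J ι⁻¹ • t  and  F̄ t • c.
  lhsComp : QMap → Carrier QA → FCar BarString → Set
  lhsComp t q z = Σ BarString λ v → t q v × Jι⁻¹ v z

  rhsComp : QMap → Carrier QA → FCar BarString → Set
  rhsComp t q z = Σ (FCar (Carrier QA)) λ y → cMem q y × Fbar t y z

  TraceEq : QMap → Set
  TraceEq t = ∀ q z → lhsComp t q z ⇔ rhsComp t q z

  _≗ₚ_ : QMap → QMap → Set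
  t ≗ₚ t' = ∀ q v → t q v ⇔ t' q v

{-# OPTIONS --safe #-}

-- The trace map is acceptance itself: tr q v holds iff some run from q accepts a word α-equivalent
-- to v. Both composites of the trace equation J ι⁻¹ • tr = F̄ tr • c describe the first step of such
-- a run, and any other solution agrees with tr by induction on the length of words, since a word is
-- determined up to α by its first letter and its tail.
--
-- Two facts carry the argument. First, α-equivalence is equality of nameless (de Bruijn) forms, in
-- which bound names become indices; so ⟨a⟩v = ⟨b⟩w in 𝔸̄*/=α amounts to |a v =α |b w. Second, tr q
-- is uniformly finitely supported: every support S of q contains the free names of the words
-- accepted from q, because a free a-successor of q is again supported by S and a bound |a-successor
-- by a ∷ S. This follows from finite branching: for d outside the support, the transpositions (d b)
-- with b fresh send the successor into finitely many classes, so by pigeonhole two of them agree,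
-- which forces (d b) to fix the successor.

module Submission where

open import Defs
open import Data.Nat using (ℕ; suc; _≟_; _+_; _≤_; s≤s)
open import Data.Nat.Properties using (≤-refl; ≤-trans; m≤m+n; <⇒≢; +-cancelˡ-≡; suc-injective)
open import Data.Fin using (Fin; toℕ)
open import Data.Fin.Properties using (pigeonhole)
open import Data.Product using (Σ; ∃; _×_; _,_; proj₁; proj₂; map₁; map₂)
open import Data.Sum using (_⊎_; inj₁; inj₂)
open import Data.Unit using (tt)
open import Data.Empty using (⊥-elim)
open import Data.List using (List; []; _∷_; _++_; map; length; lookup)
open import Data.List.Properties using (∷-injective; length-map)
open import Data.List.Extrema.Nat using (max; xs≤max)
open import Data.List.Membership.Propositional using (_∈_; _∉_; find)
open import Data.List.Membership.Propositional.Properties using (∈-map⁺; ∈-map⁻; ∈-++⁺ˡ; ∈-++⁺ʳ)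
open import Data.List.Membership.DecPropositional _≟_ using (_∈?_)
open import Data.List.Relation.Unary.All as All using ()
open import Data.List.Relation.Unary.Any using (Any; here; there; index)
open import Data.List.Relation.Unary.Any.Properties using (lookup-index)
open import Relation.Nullary using (yes; no; contradiction)
open import Relation.Nullary.Decidable using (toSum)
open import Relation.Binary.PropositionalEquality
  using (_≡_; _≢_; refl; sym; trans; cong; cong₂; subst; module ≡-Reasoning)
open import Relation.Binary.Structures using (IsEquivalence)
open import Function using (_∘_; id)
open import Function.Bundles using (_⇔_; mk⇔; Equivalence)

open Equivalence using (to; from)

-- Opaque because unfolding max over symbolic name lists makes type checking blow up.
opaque
  fresh : List 𝔸 → 𝔸
  fresh xs = suc (max 0 xs)

  fresh≤⇒∉ : ∀ xs {b} → fresh xs ≤ b → b ∉ xs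
  fresh≤⇒∉ xs fresh≤b b∈xs =
    <⇒≢ (≤-trans (s≤s (All.lookup (xs≤max 0 xs) b∈xs)) fresh≤b) refl

fresh-∉ : ∀ xs → fresh xs ∉ xs
fresh-∉ xs = fresh≤⇒∉ xs ≤-refl

freshₙ : List 𝔸 → ℕ → 𝔸
freshₙ xs n = fresh xs + n

freshₙ-∉ : ∀ xs n → freshₙ xs n ∉ xs
freshₙ-∉ xs n = fresh≤⇒∉ xs (m≤m+n (fresh xs) n)

freshₙ-injective : ∀ xs {m n} → freshₙ xs m ≡ freshₙ xs n → m ≡ n
freshₙ-injective xs = +-cancelˡ-≡ (fresh xs) _ _

module _ {x y : 𝔸} {ys : List 𝔸} where

  ∉-head : x ∉ y ∷ ys → x ≢ y
  ∉-head x∉ x≡y = x∉ (here x≡y)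

  ∉-tail : x ∉ y ∷ ys → x ∉ ys
  ∉-tail x∉ x∈ = x∉ (there x∈)

  ∈-tail : x ≢ y → x ∈ y ∷ ys → x ∈ ys
  ∈-tail x≢y (here x≡y)  = contradiction x≡y x≢y
  ∈-tail x≢y (there x∈ys) = x∈ys

module _ {x : 𝔸} (xs : List 𝔸) {ys : List 𝔸} where

  ∉-++ˡ : x ∉ xs ++ ys → x ∉ xs
  ∉-++ˡ x∉ x∈ = x∉ (∈-++⁺ˡ x∈)

  ∉-++ʳ : x ∉ xs ++ ys → x ∉ ys
  ∉-++ʳ x∉ x∈ = x∉ (∈-++⁺ʳ xs x∈)

module _ (a b : 𝔸) where

  swap-left : swapName a b a ≡ b
  swap-left with a ≟ a
  ... | yes _ = refl
  ... | no a≢a = ⊥-elim (a≢a refl)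

  swap-right : swapName a b b ≡ a
  swap-right with b ≟ a
  ... | yes b≡a = b≡a
  ... | no _ with b ≟ b
  ...   | yes _ = refl
  ...   | no b≢b = ⊥-elim (b≢b refl)

swap-other : ∀ {a b c} → c ≢ a → c ≢ b → swapName a b c ≡ c
swap-other {a} {b} {c} c≢a c≢b with c ≟ a
... | yes c≡a = ⊥-elim (c≢a c≡a)
... | no _ with c ≟ b
...   | yes c≡b = ⊥-elim (c≢b c≡b)
...   | no _ = refl

swap-fixes : ∀ {a b} S → a ∉ S → b ∉ S → ∀ c → c ∈ S → swapName a b c ≡ c
swap-fixes S a∉S b∉S c c∈S =
  swap-other (λ c≡a → a∉S (subst (_∈ S) c≡a c∈S)) (λ c≡b → b∉S (subst (_∈ S) c≡b c∈S))

swap-involutive : ∀ a b c → swapName a b (swapName a b c) ≡ c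
swap-involutive a b c with c ≟ a
... | yes refl = swap-right c b
... | no c≢a with c ≟ b
...   | yes refl = swap-left a c
...   | no c≢b = swap-other c≢a c≢b

swap-injective : ∀ a b {c d} → swapName a b c ≡ swapName a b d → c ≡ d
swap-injective a b {c} {d} eq =
  trans (sym (swap-involutive a b c)) (trans (cong (swapName a b) eq) (swap-involutive a b d))

swap-self : ∀ a c → swapName a a c ≡ c
swap-self a c with toSum (c ≟ a)
... | inj₁ refl = swap-left c c
... | inj₂ c≢a = swap-other c≢a c≢a

swap-natural : ∀ (f : 𝔸 → 𝔸) → (∀ {x y} → f x ≡ f y → x ≡ y) →
               ∀ a b c → swapName (f a) (f b) (f c) ≡ f (swapName a b c)
swap-natural f f-inj a b c with c ≟ a
... | yes refl = swap-left (f c) (f b)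
... | no c≢a with c ≟ b
...   | yes refl = swap-right (f a) (f c)
...   | no c≢b = swap-other (λ fc≡fa → c≢a (f-inj fc≡fa)) (λ fc≡fb → c≢b (f-inj fc≡fb))

swap-conjugate : ∀ a b c d x →
  swapName a b (swapName c d (swapName a b x)) ≡ swapName (swapName a b c) (swapName a b d) x
swap-conjugate a b c d x = begin
  τ (swapName c d (τ x))                 ≡⟨ swap-natural τ (swap-injective a b) c d (τ x) ⟨
  swapName (τ c) (τ d) (τ (τ x))         ≡⟨ cong (swapName (τ c) (τ d)) (swap-involutive a b x) ⟩
  swapName (τ c) (τ d) x                 ∎
  where
    open ≡-Reasoning
    τ : 𝔸 → 𝔸
    τ = swapName a b

perm-++ : ∀ π σ x → perm (π ++ σ) x ≡ perm π (perm σ x)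
perm-++ []            σ x = refl
perm-++ ((a , b) ∷ π) σ x = cong (swapName a b) (perm-++ π σ x)

inverse : Perm → Perm
inverse []      = []
inverse (p ∷ π) = inverse π ++ (p ∷ [])

perm-inverseˡ : ∀ π x → perm (inverse π) (perm π x) ≡ x
perm-inverseˡ []            x = refl
perm-inverseˡ ((a , b) ∷ π) x = begin
  perm (inverse π ++ (a , b) ∷ []) (swapName a b (perm π x)) ≡⟨ perm-++ (inverse π) _ _ ⟩
  perm (inverse π) (swapName a b (swapName a b (perm π x)))  ≡⟨ cong (perm (inverse π)) (swap-involutive a b _) ⟩
  perm (inverse π) (perm π x)                                ≡⟨ perm-inverseˡ π x ⟩
  x                                                          ∎
  where open ≡-Reasoning

perm-inverseʳ : ∀ π x → perm π (perm (inverse π) x) ≡ x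
perm-inverseʳ []            x = refl
perm-inverseʳ ((a , b) ∷ π) x = begin
  swapName a b (perm π (perm (inverse π ++ (a , b) ∷ []) x))   ≡⟨ cong (λ y → swapName a b (perm π y)) (perm-++ (inverse π) _ x) ⟩
  swapName a b (perm π (perm (inverse π) (swapName a b x)))    ≡⟨ cong (swapName a b) (perm-inverseʳ π _) ⟩
  swapName a b (swapName a b x)                                ≡⟨ swap-involutive a b x ⟩
  x                                                            ∎
  where open ≡-Reasoning

perm-injective : ∀ π {x y} → perm π x ≡ perm π y → x ≡ y
perm-injective π {x} {y} eq =
  trans (sym (perm-inverseˡ π x)) (trans (cong (perm (inverse π)) eq) (perm-inverseˡ π y))

namesᵖ : Perm → List 𝔸
namesᵖ []            = []
namesᵖ ((a , b) ∷ π) = a ∷ b ∷ namesᵖ π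

perm-fixes : ∀ π {x} → x ∉ namesᵖ π → perm π x ≡ x
perm-fixes []            x∉ = refl
perm-fixes ((a , b) ∷ π) x∉ =
  trans (cong (swapName a b) (perm-fixes π (∉-tail (∉-tail x∉))))
        (swap-other (∉-head x∉) (∉-head (∉-tail x∉)))

names : BarString → List 𝔸
names []            = []
names (plain a ∷ w) = a ∷ names w
names (bar a ∷ w)   = a ∷ names w

names-actBS : ∀ π w → names (actBS π w) ≡ map (perm π) (names w)
names-actBS π []            = refl
names-actBS π (plain a ∷ w) = cong (perm π a ∷_) (names-actBS π w)
names-actBS π (bar a ∷ w)   = cong (perm π a ∷_) (names-actBS π w)

actBS-cong : ∀ π σ w → (∀ x → x ∈ names w → perm π x ≡ perm σ x) → actBS π w ≡ actBS σ w
actBS-cong π σ []            eq = refl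
actBS-cong π σ (plain a ∷ w) eq = cong₂ _∷_ (cong plain (eq a (here refl))) (actBS-cong π σ w (λ x x∈ → eq x (there x∈)))
actBS-cong π σ (bar a ∷ w)   eq = cong₂ _∷_ (cong bar (eq a (here refl))) (actBS-cong π σ w (λ x x∈ → eq x (there x∈)))

actBS-id : ∀ π w → (∀ x → x ∈ names w → perm π x ≡ x) → actBS π w ≡ w
actBS-id π []            fix = refl
actBS-id π (plain a ∷ w) fix = cong₂ _∷_ (cong plain (fix a (here refl))) (actBS-id π w (λ x x∈ → fix x (there x∈)))
actBS-id π (bar a ∷ w)   fix = cong₂ _∷_ (cong bar (fix a (here refl))) (actBS-id π w (λ x x∈ → fix x (there x∈)))

actBS-++ : ∀ π σ w → actBS (π ++ σ) w ≡ actBS π (actBS σ w)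
actBS-++ π σ []            = refl
actBS-++ π σ (plain a ∷ w) = cong₂ _∷_ (cong plain (perm-++ π σ a)) (actBS-++ π σ w)
actBS-++ π σ (bar a ∷ w)   = cong₂ _∷_ (cong bar (perm-++ π σ a)) (actBS-++ π σ w)

actBS-inverseʳ : ∀ π w → actBS π (actBS (inverse π) w) ≡ w
actBS-inverseʳ π w =
  trans (sym (actBS-++ π (inverse π) w))
        (actBS-id (π ++ inverse π) w (λ x _ → trans (perm-++ π (inverse π) x) (perm-inverseʳ π x)))

names-supports : ∀ w → Supports Words (names w) w
names-supports w π fix = actBS-id π w fix

data Token : Set where
  binder : Token
  bound  : ℕ → Token
  free   : 𝔸 → Token

shift : Token → Token
shift (bound i) = bound (suc i)
shift t         = t

renameFree : (𝔸 → 𝔸) → Token → Token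
renameFree f (free d) = free (f d)
renameFree f t        = t

encode : List 𝔸 → 𝔸 → Token
encode []      d = free d
encode (x ∷ e) d with d ≟ x
... | yes _ = bound 0
... | no _  = shift (encode e d)

nameless : List 𝔸 → BarString → List Token
nameless e []            = []
nameless e (plain a ∷ w) = encode e a ∷ nameless e w
nameless e (bar a ∷ w)   = binder ∷ nameless (a ∷ e) w

shift-free : ∀ t {d} → shift t ≡ free d → t ≡ free d
shift-free (free x) refl = refl

shift-injective : ∀ t u → shift t ≡ shift u → t ≡ u
shift-injective binder    binder    eq   = refl
shift-injective (bound i) (bound i) refl = refl
shift-injective (free x)  (free y)  eq   = eq
shift-injective binder    (free _)  ()
shift-injective (free _)  binder    ()

renameFree-shift : ∀ f t → renameFree f (shift t) ≡ shift (renameFree f t)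
renameFree-shift f binder    = refl
renameFree-shift f (bound i) = refl
renameFree-shift f (free x)  = refl

encode-bound-or-free : ∀ e d → (∃ λ i → encode e d ≡ bound i) ⊎ (encode e d ≡ free d)
encode-bound-or-free []      d = inj₂ refl
encode-bound-or-free (x ∷ e) d with d ≟ x
... | yes _ = inj₁ (0 , refl)
... | no _ with encode-bound-or-free e d
...   | inj₁ (i , eq) = inj₁ (suc i , cong shift eq)
...   | inj₂ eq       = inj₂ (cong shift eq)

encode≢binder : ∀ e d → encode e d ≢ binder
encode≢binder e d eq with encode-bound-or-free e d
... | inj₁ (i , eq′) with trans (sym eq′) eq
...   | ()
encode≢binder e d eq | inj₂ eq′ with trans (sym eq′) eq
...   | ()

encode-free : ∀ e {d′ d} → encode e d′ ≡ free d → d′ ≡ d × d ∉ e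
encode-free []      refl = refl , λ ()
encode-free (x ∷ e) {d′} eq with d′ ≟ x
... | no d′≢x with encode-free e (shift-free (encode e d′) eq)
...   | refl , d∉e = refl , λ { (here d≡x) → d′≢x d≡x ; (there d∈e) → d∉e d∈e }

bound0≢shift : ∀ t → bound 0 ≢ shift t
bound0≢shift binder    ()
bound0≢shift (bound i) ()
bound0≢shift (free x)  ()

encode-injective : ∀ e {a b} → encode e a ≡ encode e b → a ≡ b
encode-injective []      refl = refl
encode-injective (x ∷ e) {a} {b} eq with a ≟ x | b ≟ x
... | yes a≡x | yes b≡x = trans a≡x (sym b≡x)
... | yes _   | no _    = ⊥-elim (bound0≢shift (encode e b) eq)
... | no _    | yes _   = ⊥-elim (bound0≢shift (encode e a) (sym eq))
... | no _    | no _    = encode-injective e (shift-injective _ _ eq)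

encode-map : ∀ (f : 𝔸 → 𝔸) → (∀ {x y} → f x ≡ f y → x ≡ y) →
             ∀ e d → encode (map f e) (f d) ≡ renameFree f (encode e d)
encode-map f f-inj []      d = refl
encode-map f f-inj (x ∷ e) d with f d ≟ f x | d ≟ x
... | yes _      | yes _    = refl
... | yes fd≡fx  | no d≢x   = ⊥-elim (d≢x (f-inj fd≡fx))
... | no fd≢fx   | yes refl = ⊥-elim (fd≢fx refl)
... | no _       | no _     =
  trans (cong shift (encode-map f f-inj e d)) (sym (renameFree-shift f (encode e d)))

encode-fixed : ∀ (f : 𝔸 → 𝔸) e d → f d ≡ d → renameFree f (encode e d) ≡ encode e d
encode-fixed f e d fd≡d with encode-bound-or-free e d
... | inj₁ (i , eq) rewrite eq = refl
... | inj₂ eq       rewrite eq = cong free fd≡d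

encode-++ : ∀ e e′ {d′ d} → encode (e ++ e′) d′ ≡ free d → encode e d′ ≡ free d
encode-++ []      e′ eq with encode-free e′ eq
... | refl , _ = refl
encode-++ (x ∷ e) e′ {d′} eq with d′ ≟ x
... | no _ = cong shift (encode-++ e e′ (shift-free _ eq))

length-nameless : ∀ e w → length (nameless e w) ≡ length w
length-nameless e []            = refl
length-nameless e (plain a ∷ w) = cong suc (length-nameless e w)
length-nameless e (bar a ∷ w)   = cong suc (length-nameless (a ∷ e) w)

nameless-actBS : ∀ π e w → nameless (map (perm π) e) (actBS π w) ≡ map (renameFree (perm π)) (nameless e w)
nameless-actBS π e []            = refl
nameless-actBS π e (plain a ∷ w) = cong₂ _∷_ (encode-map (perm π) (perm-injective π) e a) (nameless-actBS π e w)
nameless-actBS π e (bar a ∷ w)   = cong (binder ∷_) (nameless-actBS π (a ∷ e) w)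

nameless-cong : ∀ e e′ w → (∀ d → d ∈ names w → encode e d ≡ encode e′ d) → nameless e w ≡ nameless e′ w
nameless-cong e e′ []            eq = refl
nameless-cong e e′ (plain a ∷ w) eq = cong₂ _∷_ (eq a (here refl)) (nameless-cong e e′ w (λ d d∈ → eq d (there d∈)))
nameless-cong e e′ (bar a ∷ w)   eq = cong (binder ∷_) (nameless-cong (a ∷ e) (a ∷ e′) w eq′)
  where
    eq′ : ∀ d → d ∈ names w → encode (a ∷ e) d ≡ encode (a ∷ e′) d
    eq′ d d∈ with d ≟ a
    ... | yes _ = refl
    ... | no _  = cong shift (eq d (there d∈))

free∈nameless : ∀ e w {d} → free d ∈ nameless e w → d ∈ names w × d ∉ e
free∈nameless e (plain a ∷ w) (here eq) with encode-free e (sym eq)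
... | refl , d∉e = here refl , d∉e
free∈nameless e (plain a ∷ w) (there d∈) with free∈nameless e w d∈
... | d∈w , d∉e = there d∈w , d∉e
free∈nameless e (bar a ∷ w) (there d∈) with free∈nameless (a ∷ e) w d∈
... | d∈w , d∉ae = there d∈w , ∉-tail d∉ae

free∈nameless-++ : ∀ e e′ w {d} → free d ∈ nameless (e ++ e′) w → free d ∈ nameless e w
free∈nameless-++ e e′ (plain a ∷ w) (here eq) = here (sym (encode-++ e e′ (sym eq)))
free∈nameless-++ e e′ (plain a ∷ w) (there d∈) = there (free∈nameless-++ e e′ w d∈)
free∈nameless-++ e e′ (bar a ∷ w)   (there d∈) = there (free∈nameless-++ (a ∷ e) e′ w d∈)

renameFree-id : ∀ f ts → (∀ d → free d ∈ ts → f d ≡ d) → map (renameFree f) ts ≡ ts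
renameFree-id f []              fix = refl
renameFree-id f (binder ∷ ts)   fix = cong (binder ∷_) (renameFree-id f ts (λ d d∈ → fix d (there d∈)))
renameFree-id f (bound i ∷ ts)  fix = cong (bound i ∷_) (renameFree-id f ts (λ d d∈ → fix d (there d∈)))
renameFree-id f (free x ∷ ts)   fix = cong₂ _∷_ (cong free (fix x (here refl))) (renameFree-id f ts (λ d d∈ → fix d (there d∈)))

envAfter : List 𝔸 → BarString → List 𝔸
envAfter e []            = e
envAfter e (plain a ∷ x) = envAfter e x
envAfter e (bar a ∷ x)   = envAfter (a ∷ e) x

nameless-++ : ∀ e x y → nameless e (x ++ y) ≡ nameless e x ++ nameless (envAfter e x) y
nameless-++ e []            y = refl
nameless-++ e (plain a ∷ x) y = cong (encode e a ∷_) (nameless-++ e x y)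
nameless-++ e (bar a ∷ x)   y = cong (binder ∷_) (nameless-++ (a ∷ e) x y)

encode-map-fixed : ∀ (f : 𝔸 → 𝔸) → (∀ {x y} → f x ≡ f y → x ≡ y) →
                   ∀ e d → f d ≡ d → encode (map f e) d ≡ encode e d
encode-map-fixed f f-inj e d fd≡d = begin
  encode (map f e) d          ≡⟨ cong (encode (map f e)) fd≡d ⟨
  encode (map f e) (f d)      ≡⟨ encode-map f f-inj e d ⟩
  renameFree f (encode e d)   ≡⟨ encode-fixed f e d fd≡d ⟩
  encode e d                  ∎
  where open ≡-Reasoning

nameless-rename : ∀ a c e u → c ∉ names u → c ≢ a →
                  nameless (c ∷ e) (actBS (tr₂ a c) u) ≡ nameless (a ∷ e) u
nameless-rename a c e u c∉u c≢a = begin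
  nameless (c ∷ e) (actBS π u)                   ≡⟨ nameless-cong _ _ (actBS π u) same-encoding ⟩
  nameless (map (perm π) (a ∷ e)) (actBS π u)    ≡⟨ nameless-actBS π (a ∷ e) u ⟩
  map (renameFree (perm π)) (nameless (a ∷ e) u) ≡⟨ renameFree-id (perm π) _ fixes-free ⟩
  nameless (a ∷ e) u                             ∎
  where
    open ≡-Reasoning
    π : Perm
    π = tr₂ a c

    a∉πu : ∀ {d} → d ∈ names (actBS π u) → d ≢ a
    a∉πu {d} d∈ refl with ∈-map⁻ (perm π) (subst (d ∈_) (names-actBS π u) d∈)
    ... | y , y∈u , d≡πy =
      c∉u (subst (_∈ names u) (swap-injective a c (trans (sym d≡πy) (sym (swap-right d c)))) y∈u)

    same-encoding : ∀ d → d ∈ names (actBS π u) → encode (c ∷ e) d ≡ encode (map (perm π) (a ∷ e)) d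
    same-encoding d d∈ with d ≟ c | d ≟ swapName a c a
    ... | yes _   | yes _   = refl
    ... | yes d≡c | no d≢πa = ⊥-elim (d≢πa (trans d≡c (sym (swap-left a c))))
    ... | no d≢c  | yes d≡πa = ⊥-elim (d≢c (trans d≡πa (swap-left a c)))
    ... | no d≢c  | no _    =
      cong shift (sym (encode-map-fixed (perm π) (perm-injective π) e d (swap-other (a∉πu d∈) d≢c)))

    fixes-free : ∀ d → free d ∈ nameless (a ∷ e) u → perm π d ≡ d
    fixes-free d d∈ with free∈nameless (a ∷ e) u d∈
    ... | d∈u , d∉ae = swap-other (∉-head d∉ae) (λ d≡c → c∉u (subst (_∈ names u) d≡c d∈u))

∷-resp-=α : ∀ σ {u v} → u =α v → (σ ∷ u) =α (σ ∷ v)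
∷-resp-=α σ α-refl                 = α-refl
∷-resp-=α σ (α-sym p)              = α-sym (∷-resp-=α σ p)
∷-resp-=α σ (α-trans p q)          = α-trans (∷-resp-=α σ p) (∷-resp-=α σ q)
∷-resp-=α σ (α-step x a b v w abs) = α-step (σ ∷ x) a b v w abs

#Words⇒∉names : ∀ {c w} → c #[ Words ] w → c ∉ names w
#Words⇒∉names {c} {w} (S , S-supports , c∉S) c∈w = fresh-∉ L (there (∈-++⁺ʳ S d∈w))
  where
    L : List 𝔸
    L = c ∷ S ++ names w
    d : 𝔸
    d = fresh L
    swap-fixes-w : actBS (tr₂ c d) w ≡ w
    swap-fixes-w = S-supports (tr₂ c d) (swap-fixes S c∉S (∉-++ˡ S (∉-tail (fresh-∉ L))))
    d∈πw : d ∈ names (actBS (tr₂ c d) w)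
    d∈πw = subst (d ∈_) (sym (names-actBS (tr₂ c d) w))
                 (subst (_∈ map (swapName c d) (names w)) (swap-left c d) (∈-map⁺ (swapName c d) c∈w))
    d∈w : d ∈ names w
    d∈w = subst (λ v → d ∈ names v) swap-fixes-w d∈πw

AbsEq-Words⇒nameless≡ : ∀ {a v b w} → AbsEq Words a v b w → ∀ e → nameless (a ∷ e) v ≡ nameless (b ∷ e) w
AbsEq-Words⇒nameless≡ {a} {v} {b} {w} (c , (c≢a , c≢b , c#v , c#w) , πv≡πw) e = begin
  nameless (a ∷ e) v                  ≡⟨ nameless-rename a c e v (#Words⇒∉names c#v) c≢a ⟨
  nameless (c ∷ e) (actBS (tr₂ a c) v) ≡⟨ cong (nameless (c ∷ e)) πv≡πw ⟩
  nameless (c ∷ e) (actBS (tr₂ b c) w) ≡⟨ nameless-rename b c e w (#Words⇒∉names c#w) c≢b ⟩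
  nameless (b ∷ e) w                  ∎
  where open ≡-Reasoning

=α⇒nameless≡ : ∀ {u v} → u =α v → ∀ e → nameless e u ≡ nameless e v
=α⇒nameless≡ α-refl        e = refl
=α⇒nameless≡ (α-sym p)     e = sym (=α⇒nameless≡ p e)
=α⇒nameless≡ (α-trans p q) e = trans (=α⇒nameless≡ p e) (=α⇒nameless≡ q e)
=α⇒nameless≡ (α-step x a b v w abs) e = begin
  nameless e (x ++ bar a ∷ v)                                     ≡⟨ nameless-++ e x (bar a ∷ v) ⟩
  nameless e x ++ binder ∷ nameless (a ∷ envAfter e x) v          ≡⟨ cong (λ t → nameless e x ++ binder ∷ t)
                                                                        (AbsEq-Words⇒nameless≡ abs (envAfter e x)) ⟩
  nameless e x ++ binder ∷ nameless (b ∷ envAfter e x) w          ≡⟨ nameless-++ e x (bar b ∷ w) ⟨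
  nameless e (x ++ bar b ∷ w)                                     ∎
  where open ≡-Reasoning

∉names-actBS : ∀ π {d} u → perm π d ≡ d → d ∉ names u → d ∉ names (actBS π u)
∉names-actBS π {d} u πd≡d d∉u d∈πu with ∈-map⁻ (perm π) (subst (d ∈_) (names-actBS π u) d∈πu)
... | y , y∈u , d≡πy = d∉u (subst (_∈ names u) (perm-injective π (trans (sym d≡πy) (sym πd≡d))) y∈u)

AbsEq-Words-rename : ∀ a c u → c ∉ names u → c ≢ a → AbsEq Words a u c (actBS (tr₂ a c) u)
AbsEq-Words-rename a c u c∉u c≢a =
  d , (d≢a , d≢c , (names u , names-supports u , d∉u) , (names u′ , names-supports u′ , d∉u′)) , same
  where
    L : List 𝔸
    L  = a ∷ c ∷ names u
    d : 𝔸
    d  = fresh L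
    u′ : BarString
    u′ = actBS (tr₂ a c) u
    d≢a : d ≢ a
    d≢a = ∉-head (fresh-∉ L)
    d≢c : d ≢ c
    d≢c = ∉-head (∉-tail (fresh-∉ L))
    d∉u : d ∉ names u
    d∉u = ∉-tail (∉-tail (fresh-∉ L))
    d∉u′ : d ∉ names u′
    d∉u′ = ∉names-actBS (tr₂ a c) u (swap-other d≢a d≢c) d∉u

    pointwise : ∀ x → x ∈ names u → swapName a d x ≡ swapName c d (swapName a c x)
    pointwise x x∈u with toSum (x ≟ a)
    ... | inj₁ refl = trans (swap-left x d) (sym (trans (cong (swapName c d) (swap-left x c)) (swap-left c d)))
    ... | inj₂ x≢a  = trans (swap-other x≢a x≢d) (sym (trans (cong (swapName c d) (swap-other x≢a x≢c)) (swap-other x≢c x≢d)))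
      where
        x≢c : x ≢ c
        x≢c x≡c = c∉u (subst (_∈ names u) x≡c x∈u)
        x≢d : x ≢ d
        x≢d x≡d = d∉u (subst (_∈ names u) x≡d x∈u)

    same : actBS (tr₂ a d) u ≡ actBS (tr₂ c d) u′
    same = trans (actBS-cong (tr₂ a d) (tr₂ c d ++ tr₂ a c) u pointwise) (actBS-++ (tr₂ c d) (tr₂ a c) u)

nameless≡⇒=α : ∀ e {u v} → nameless e u ≡ nameless e v → u =α v
nameless≡⇒=α e {u} = go (length u) e u _ refl
  where
    -- The recursive call is on a renamed tail, hence the length as fuel.
    go : ∀ n e u v → length u ≡ n → nameless e u ≡ nameless e v → u =α v
    go n       e []            []            _   _  = α-refl
    go n       e []            (plain _ ∷ _) _   ()
    go n       e []            (bar _ ∷ _)   _   ()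
    go n       e (plain _ ∷ _) []            _   ()
    go n       e (bar _ ∷ _)   []            _   ()
    go (suc n) e (plain a ∷ u) (plain b ∷ v) len eq with ∷-injective eq
    ... | a≡b , u≡v with encode-injective e a≡b
    ...   | refl = ∷-resp-=α (plain a) (go n e u v (suc-injective len) u≡v)
    go n e (plain a ∷ u) (bar b ∷ v)   _ eq = ⊥-elim (encode≢binder e a (proj₁ (∷-injective eq)))
    go n e (bar a ∷ u)   (plain b ∷ v) _ eq = ⊥-elim (encode≢binder e b (sym (proj₁ (∷-injective eq))))
    go (suc n) e (bar a ∷ u) (bar b ∷ v) len eq =
      α-trans (α-step [] a c u u′ (AbsEq-Words-rename a c u c∉u c≢a))
        (α-trans (∷-resp-=α (bar c) (go n (c ∷ e) u′ v′ len′ u′≡v′))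
                 (α-sym (α-step [] b c v v′ (AbsEq-Words-rename b c v c∉v c≢b))))
      where
        L : List 𝔸
        L  = a ∷ b ∷ names u ++ names v
        c : 𝔸
        c  = fresh L
        c≢a : c ≢ a
        c≢a = ∉-head (fresh-∉ L)
        c≢b : c ≢ b
        c≢b = ∉-head (∉-tail (fresh-∉ L))
        c∉u : c ∉ names u
        c∉u = ∉-++ˡ (names u) (∉-tail (∉-tail (fresh-∉ L)))
        c∉v : c ∉ names v
        c∉v = ∉-++ʳ (names u) (∉-tail (∉-tail (fresh-∉ L)))
        u′ v′ : BarString
        u′ = actBS (tr₂ a c) u
        v′ = actBS (tr₂ b c) v
        len′ : length u′ ≡ n
        len′ = trans (length-map _ u) (suc-injective len)
        u′≡v′ : nameless (c ∷ e) u′ ≡ nameless (c ∷ e) v′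
        u′≡v′ = trans (nameless-rename a c e u c∉u c≢a)
                  (trans (proj₂ (∷-injective eq)) (sym (nameless-rename b c e v c∉v c≢b)))

names-supports-=α : ∀ w → Supports BarLang (names w) w
names-supports-=α w π fix = subst (_=α w) (sym (actBS-id π w fix)) α-refl

#BarLang⇒free∉ : ∀ {c w} → c #[ BarLang ] w → free c ∉ nameless [] w
#BarLang⇒free∉ {c} {w} (S , S-supports , c∉S) c∈w = fresh-∉ L (there (∈-++⁺ʳ S d∈w))
  where
    L : List 𝔸
    L = c ∷ S ++ names w
    d : 𝔸
    d = fresh L
    π : Perm
    π = tr₂ c d
    swap-fixes-w : map (renameFree (perm π)) (nameless [] w) ≡ nameless [] w
    swap-fixes-w = trans (sym (nameless-actBS π [] w))
                         (=α⇒nameless≡ (S-supports π (swap-fixes S c∉S (∉-++ˡ S (∉-tail (fresh-∉ L))))) [])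
    free-d∈w : free d ∈ nameless [] w
    free-d∈w = subst (free d ∈_) swap-fixes-w
                 (subst (λ x → free x ∈ map (renameFree (perm π)) (nameless [] w)) (swap-left c d)
                        (∈-map⁺ (renameFree (perm π)) c∈w))
    d∈w : d ∈ names w
    d∈w = proj₁ (free∈nameless [] w free-d∈w)

-- Unlike nameless-rename, c may occur bound in v.
nameless-rename-free : ∀ a c v → c ≢ a → free c ∉ nameless [] v →
                       nameless (c ∷ []) (actBS (tr₂ a c) v) ≡ nameless (a ∷ []) v
nameless-rename-free a c v c≢a c∉v = begin
  nameless (c ∷ []) (actBS π v)                 ≡⟨ cong (λ x → nameless (x ∷ []) (actBS π v)) (swap-left a c) ⟨
  nameless (map (perm π) (a ∷ [])) (actBS π v)  ≡⟨ nameless-actBS π (a ∷ []) v ⟩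
  map (renameFree (perm π)) (nameless (a ∷ []) v) ≡⟨ renameFree-id (perm π) _ fixes-free ⟩
  nameless (a ∷ []) v                           ∎
  where
    open ≡-Reasoning
    π : Perm
    π = tr₂ a c
    fixes-free : ∀ d → free d ∈ nameless (a ∷ []) v → perm π d ≡ d
    fixes-free d d∈ = swap-other (∉-head (proj₂ (free∈nameless (a ∷ []) v d∈)))
                                 (λ { refl → c∉v (free∈nameless-++ [] (a ∷ []) v d∈) })

AbsEq-BarLang⇒nameless≡ : ∀ {a v b w} → AbsEq BarLang a v b w → nameless (a ∷ []) v ≡ nameless (b ∷ []) w
AbsEq-BarLang⇒nameless≡ {a} {v} {b} {w} (c , (c≢a , c≢b , c#v , c#w) , πv=πw) = begin
  nameless (a ∷ []) v                   ≡⟨ nameless-rename-free a c v c≢a (#BarLang⇒free∉ c#v) ⟨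
  nameless (c ∷ []) (actBS (tr₂ a c) v) ≡⟨ =α⇒nameless≡ πv=πw (c ∷ []) ⟩
  nameless (c ∷ []) (actBS (tr₂ b c) w) ≡⟨ nameless-rename-free b c w c≢b (#BarLang⇒free∉ c#w) ⟩
  nameless (b ∷ []) w                   ∎
  where open ≡-Reasoning

nameless≡⇒AbsEq-BarLang : ∀ {a v b w} → nameless (a ∷ []) v ≡ nameless (b ∷ []) w → AbsEq BarLang a v b w
nameless≡⇒AbsEq-BarLang {a} {v} {b} {w} eq =
  c , (c≢a , c≢b , (names v , names-supports-=α v , c∉v) , (names w , names-supports-=α w , c∉w)) ,
  nameless≡⇒=α (c ∷ []) (trans (nameless-rename a c [] v c∉v c≢a) (trans eq (sym (nameless-rename b c [] w c∉w c≢b))))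
  where
    L : List 𝔸
    L = a ∷ b ∷ names v ++ names w
    c : 𝔸
    c = fresh L
    c≢a : c ≢ a
    c≢a = ∉-head (fresh-∉ L)
    c≢b : c ≢ b
    c≢b = ∉-head (∉-tail (fresh-∉ L))
    c∉v : c ∉ names v
    c∉v = ∉-++ˡ (names v) (∉-tail (∉-tail (fresh-∉ L)))
    c∉w : c ∉ names w
    c∉w = ∉-++ʳ (names v) (∉-tail (∉-tail (fresh-∉ L)))

AbsEq-BarLang⇔=α : ∀ {a v b w} → AbsEq BarLang a v b w ⇔ (bar a ∷ v) =α (bar b ∷ w)
AbsEq-BarLang⇔=α = mk⇔
  (λ abs → nameless≡⇒=α [] (cong (binder ∷_) (AbsEq-BarLang⇒nameless≡ abs)))
  (λ eq → nameless≡⇒AbsEq-BarLang (proj₂ (∷-injective (=α⇒nameless≡ eq []))))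

actBS-resp-=α : ∀ π {u v} → u =α v → actBS π u =α actBS π v
actBS-resp-=α π {u} {v} u=v = nameless≡⇒=α [] (begin
  nameless [] (actBS π u)                       ≡⟨ nameless-actBS π [] u ⟩
  map (renameFree (perm π)) (nameless [] u)     ≡⟨ cong (map (renameFree (perm π))) (=α⇒nameless≡ u=v []) ⟩
  map (renameFree (perm π)) (nameless [] v)     ≡⟨ nameless-actBS π [] v ⟨
  nameless [] (actBS π v)                       ∎)
  where open ≡-Reasoning

=α-length : ∀ {u v} → u =α v → length u ≡ length v
=α-length {u} {v} u=v =
  trans (sym (length-nameless [] u)) (trans (cong length (=α⇒nameless≡ u=v [])) (length-nameless [] v))

free-names-supports : ∀ {S} v → (∀ d → free d ∈ nameless [] v → d ∈ S) → Supports BarLang S v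
free-names-supports {S} v free⊆S π π-fixes-S = nameless≡⇒=α [] (begin
  nameless [] (actBS π v)                   ≡⟨ nameless-actBS π [] v ⟩
  map (renameFree (perm π)) (nameless [] v) ≡⟨ renameFree-id (perm π) _ (λ d d∈ → π-fixes-S d (free⊆S d d∈)) ⟩
  nameless [] v                             ∎)
  where open ≡-Reasoning

-- ι is the structure map F(𝔸̄*/=α) → 𝔸̄*/=α, of which Jι⁻¹ is the inverse.
ι : FCar BarString → BarString
ι star     = []
ι (pl a v) = plain a ∷ v
ι (ab a v) = bar a ∷ v

plain-=α⁻ : ∀ {a u b v} → (plain a ∷ u) =α (plain b ∷ v) → a ≡ b × u =α v
plain-=α⁻ au=bv with ∷-injective (=α⇒nameless≡ au=bv [])
... | refl , u≡v = refl , nameless≡⇒=α [] u≡v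

FEq-BarLang⇔ : ∀ z z′ → FEq BarLang z z′ ⇔ ι z =α ι z′
FEq-BarLang⇔ star     star     = mk⇔ (λ _ → α-refl) (λ _ → tt)
FEq-BarLang⇔ (pl a u) (pl b v) = mk⇔ (λ { (refl , u=v) → ∷-resp-=α (plain a) u=v }) plain-=α⁻
FEq-BarLang⇔ (ab a u) (ab b v) = AbsEq-BarLang⇔=α
FEq-BarLang⇔ star     (pl b v) = mk⇔ (λ ()) (λ eq → contradiction (=α⇒nameless≡ eq []) λ ())
FEq-BarLang⇔ star     (ab b v) = mk⇔ (λ ()) (λ eq → contradiction (=α⇒nameless≡ eq []) λ ())
FEq-BarLang⇔ (pl a u) star     = mk⇔ (λ ()) (λ eq → contradiction (=α⇒nameless≡ eq []) λ ())
FEq-BarLang⇔ (pl a u) (ab b v) = mk⇔ (λ ()) (λ eq → contradiction (=α⇒nameless≡ eq []) λ ())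
FEq-BarLang⇔ (ab a u) star     = mk⇔ (λ ()) (λ eq → contradiction (=α⇒nameless≡ eq []) λ ())
FEq-BarLang⇔ (ab a u) (pl b v) = mk⇔ (λ ()) (λ eq → contradiction (=α⇒nameless≡ eq []) λ ())

module Nominal (X : Act) (X-nominal : IsNominal X) where
  open IsNominal X-nominal
  open IsEquivalence isEquiv renaming (refl to ≈-refl; sym to ≈-sym; trans to ≈-trans)

  infix  4 _≈ₓ_
  infixr 5 _·_

  _≈ₓ_ : Carrier X → Carrier X → Set
  _≈ₓ_ = _≈_ X

  _·_ : Perm → Carrier X → Carrier X
  _·_ = act X

  supp : Carrier X → List 𝔸
  supp x = proj₁ (finSupp x)

  supp-supports : ∀ x → Supports X (supp x) x
  supp-supports x = proj₂ (finSupp x)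

  act-∘ : ∀ π σ τ x → (∀ z → perm π (perm σ z) ≡ perm τ z) → π · σ · x ≈ₓ τ · x
  act-∘ π σ τ x eq = ≈-trans (≈-sym (act-comp π σ x)) (act-ext (π ++ σ) τ x (λ z → trans (perm-++ π σ z) (eq z)))

  act-∘∘ : ∀ π σ ρ τ x → (∀ z → perm π (perm σ (perm ρ z)) ≡ perm τ z) → π · σ · ρ · x ≈ₓ τ · x
  act-∘∘ π σ ρ τ x eq =
    ≈-trans (act-resp π (act-∘ σ ρ (σ ++ ρ) x (λ z → sym (perm-++ σ ρ z))))
            (act-∘ π (σ ++ ρ) τ x (λ z → trans (cong (perm π) (perm-++ σ ρ z)) (eq z)))

  swap-swap : ∀ a b x → tr₂ a b · tr₂ a b · x ≈ₓ x
  swap-swap a b x = ≈-trans (act-∘ (tr₂ a b) (tr₂ a b) [] x (swap-involutive a b)) (act-id x)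

  supports-swap : ∀ {S x a b} → Supports X S x → a ∉ S → b ∉ S → tr₂ a b · x ≈ₓ x
  supports-swap {S} S-supports a∉S b∉S = S-supports _ (swap-fixes S a∉S b∉S)

  supports-resp : ∀ {S x y} → Supports X S x → x ≈ₓ y → Supports X S y
  supports-resp S-supports x≈y π fix = ≈-trans (act-resp π (≈-sym x≈y)) (≈-trans (S-supports π fix) x≈y)

  supports-mono : ∀ {S S′ x} → Supports X S x → (∀ a → a ∈ S → a ∈ S′) → Supports X S′ x
  supports-mono S-supports S⊆S′ π fix = S-supports π (λ a a∈S → fix a (S⊆S′ a a∈S))

  supports-swap-conj : ∀ {T x} a b → Supports X T x → Supports X (map (swapName a b) T) (tr₂ a b · x)
  supports-swap-conj {T} {x} a b T-supports ρ fix =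
    ≈-trans (≈-sym (swap-swap a b (ρ · tr₂ a b · x)))
            (act-resp (tr₂ a b) (≈-trans (act-∘∘ (tr₂ a b) ρ (tr₂ a b) ρ′ x (λ z → sym (ρ′-conj z)))
                                         (T-supports ρ′ ρ′-fixes-T)))
    where
      ρ′ : Perm
      ρ′ = tr₂ a b ++ ρ ++ tr₂ a b
      ρ′-conj : ∀ z → perm ρ′ z ≡ swapName a b (perm ρ (swapName a b z))
      ρ′-conj z = trans (perm-++ (tr₂ a b) (ρ ++ tr₂ a b) z) (cong (swapName a b) (perm-++ ρ (tr₂ a b) z))
      ρ′-fixes-T : ∀ t → t ∈ T → perm ρ′ t ≡ t
      ρ′-fixes-T t t∈T = trans (ρ′-conj t)
        (trans (cong (swapName a b) (fix _ (∈-map⁺ (swapName a b) t∈T))) (swap-involutive a b t))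

  #-swap : ∀ {c c′ x} → c #[ X ] x → c′ #[ X ] x → tr₂ c c′ · x ≈ₓ x
  #-swap {c} {c′} {x} (S₁ , S₁-supports , c∉S₁) (S₂ , S₂-supports , c′∉S₂) with toSum (c ≟ c′)
  ... | inj₁ refl  = ≈-trans (act-ext (tr₂ c c) [] x (swap-self c)) (act-id x)
  ... | inj₂ c≢c′ =
    ≈-trans (≈-sym (act-∘∘ (tr₂ c′ e) (tr₂ c e) (tr₂ c′ e) (tr₂ c c′) x conj))
      (≈-trans (act-resp (tr₂ c′ e) (act-resp (tr₂ c e) c′e-fixes))
        (≈-trans (act-resp (tr₂ c′ e) ce-fixes) c′e-fixes))
    where
      L : List 𝔸
      L = c ∷ c′ ∷ S₁ ++ S₂
      e : 𝔸
      e = fresh L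
      ce-fixes : tr₂ c e · x ≈ₓ x
      ce-fixes = supports-swap S₁-supports c∉S₁ (∉-++ˡ S₁ (∉-tail (∉-tail (fresh-∉ L))))
      c′e-fixes : tr₂ c′ e · x ≈ₓ x
      c′e-fixes = supports-swap S₂-supports c′∉S₂ (∉-++ʳ S₁ (∉-tail (∉-tail (fresh-∉ L))))
      conj : ∀ z → swapName c′ e (swapName c e (swapName c′ e z)) ≡ swapName c c′ z
      conj z = trans (swap-conjugate c′ e c e z)
        (cong₂ (λ p q → swapName p q z) (swap-other c≢c′ (λ c≡e → ∉-head (fresh-∉ L) (sym c≡e))) (swap-right c′ e))

  -- (d b′) = (b b′)(d b)(b b′) fixes x as well, and conjugating the support by it replaces d with b′.
  supports-rename : ∀ {d T x b} → Supports X (d ∷ T) x → b ∉ d ∷ T → tr₂ d b · x ≈ₓ x → d ∉ T →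
                    ∀ b′ → b′ ∉ d ∷ b ∷ T → Supports X (b′ ∷ T) x
  supports-rename {d} {T} {x} {b} dT-supports b∉dT db-fixes d∉T b′ b′∉ =
    supports-mono (supports-resp (supports-swap-conj d b′ dT-supports) db′-fixes) image⊆
    where
      b′∉dT : b′ ∉ d ∷ T
      b′∉dT (here b′≡d)  = b′∉ (here b′≡d)
      b′∉dT (there b′∈T) = b′∉ (there (there b′∈T))
      bb′-fixes : tr₂ b b′ · x ≈ₓ x
      bb′-fixes = supports-swap dT-supports b∉dT b′∉dT
      conj : ∀ z → swapName b b′ (swapName d b (swapName b b′ z)) ≡ swapName d b′ z
      conj z = trans (swap-conjugate b b′ d b z)
        (cong₂ (λ p q → swapName p q z) (swap-other (λ d≡b → b∉dT (here (sym d≡b))) (λ d≡b′ → b′∉ (here (sym d≡b′))))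
                                        (swap-left b b′))
      db′-fixes : tr₂ d b′ · x ≈ₓ x
      db′-fixes = ≈-trans (≈-sym (act-∘∘ (tr₂ b b′) (tr₂ d b) (tr₂ b b′) (tr₂ d b′) x conj))
        (≈-trans (act-resp (tr₂ b b′) (act-resp (tr₂ d b) bb′-fixes))
          (≈-trans (act-resp (tr₂ b b′) db-fixes) bb′-fixes))
      image⊆ : ∀ y → y ∈ map (swapName d b′) (d ∷ T) → y ∈ b′ ∷ T
      image⊆ y y∈ with ∈-map⁻ (swapName d b′) {xs = d ∷ T} y∈
      ... | t , here refl , refl = here (swap-left t b′)
      ... | t , there t∈T , refl = there (subst (_∈ T) (sym (swap-fixes T d∉T (∉-tail b′∉dT) t t∈T)) t∈T)

  supports-drop : ∀ {d T x b} → Supports X (d ∷ T) x → b ∉ d ∷ T → tr₂ d b · x ≈ₓ x → Supports X T x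
  supports-drop {d} {T} {x} {b} dT-supports b∉dT db-fixes with d ∈? T
  ... | yes d∈T = supports-mono dT-supports (λ { _ (here refl) → d∈T ; _ (there a∈T) → a∈T })
  ... | no d∉T  = λ ρ ρ-fixes-T →
    supports-rename dT-supports b∉dT db-fixes d∉T (b′ ρ) (b′∉dbT ρ) ρ (b′T-fixed ρ ρ-fixes-T)
    where
      L : Perm → List 𝔸
      L ρ = (d ∷ b ∷ T) ++ namesᵖ ρ
      b′ : Perm → 𝔸
      b′ ρ = fresh (L ρ)
      b′∉dbT : ∀ ρ → b′ ρ ∉ d ∷ b ∷ T
      b′∉dbT ρ = ∉-++ˡ (d ∷ b ∷ T) (fresh-∉ (L ρ))
      b′T-fixed : ∀ ρ → (∀ a → a ∈ T → perm ρ a ≡ a) → ∀ a → a ∈ b′ ρ ∷ T → perm ρ a ≡ a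
      b′T-fixed ρ ρ-fixes-T _ (here refl)  = perm-fixes ρ (∉-++ʳ (d ∷ b ∷ T) (fresh-∉ (L ρ)))
      b′T-fixed ρ ρ-fixes-T a (there a∈T) = ρ-fixes-T a a∈T

  swap-coincidence : ∀ {T x d b b′} → Supports X T x → b ∉ T → b′ ∉ T → d ≢ b → d ≢ b′ → b ≢ b′ →
                     tr₂ d b · x ≈ₓ tr₂ d b′ · x → tr₂ d b · x ≈ₓ x
  swap-coincidence {T} {x} {d} {b} {b′} T-supports b∉T b′∉T d≢b d≢b′ b≢b′ same =
    ≈-trans db≈bb′ bb′-fixes
    where
      bb′-fixes : tr₂ b b′ · x ≈ₓ x
      bb′-fixes = supports-swap T-supports b∉T b′∉T
      conj : ∀ z → swapName d b (swapName d b′ z) ≡ swapName b b′ (swapName d b z)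
      conj z = trans (cong (λ y → swapName d b (swapName d b′ y)) (sym (swap-involutive d b z)))
        (trans (swap-conjugate d b d b′ (swapName d b z))
          (cong₂ (λ p q → swapName p q (swapName d b z)) (swap-left d b)
                 (swap-other (λ b′≡d → d≢b′ (sym b′≡d)) (λ b′≡b → b≢b′ (sym b′≡b)))))
      x≈bb′db : x ≈ₓ tr₂ b b′ · tr₂ d b · x
      x≈bb′db = ≈-trans (≈-sym (swap-swap d b x)) (≈-trans (act-resp (tr₂ d b) same)
        (≈-trans (act-∘ (tr₂ d b) (tr₂ d b′) (tr₂ b b′ ++ tr₂ d b) x
                   (λ z → trans (conj z) (sym (perm-++ (tr₂ b b′) (tr₂ d b) z))))
                 (act-comp (tr₂ b b′) (tr₂ d b) x)))
      db≈bb′ : tr₂ d b · x ≈ₓ tr₂ b b′ · x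
      db≈bb′ = ≈-trans (≈-sym (swap-swap b b′ (tr₂ d b · x))) (act-resp (tr₂ b b′) (≈-sym x≈bb′db))

  ∉supp⇒# : ∀ {c} x → c ∉ supp x → c #[ X ] x
  ∉supp⇒# x c∉ = supp x , supp-supports x , c∉

  private
    swap-past-fresh : ∀ {a c c′} → c ≢ a → c′ ≢ a → ∀ y →
                      tr₂ a c′ · tr₂ c c′ · y ≈ₓ tr₂ c c′ · tr₂ a c · y
    swap-past-fresh {a} {c} {c′} c≢a c′≢a y =
      ≈-trans (act-∘ (tr₂ a c′) (tr₂ c c′) (tr₂ c c′ ++ tr₂ a c) y pointwise) (act-comp (tr₂ c c′) (tr₂ a c) y)
      where
        pointwise : ∀ z → swapName a c′ (swapName c c′ z) ≡ perm (tr₂ c c′ ++ tr₂ a c) z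
        pointwise z = sym (begin
          swapName c c′ (swapName a c z)                                   ≡⟨ cong (λ w → swapName c c′ (swapName a c w)) (swap-involutive c c′ z) ⟨
          swapName c c′ (swapName a c (swapName c c′ (swapName c c′ z)))   ≡⟨ swap-conjugate c c′ a c (swapName c c′ z) ⟩
          swapName (swapName c c′ a) (swapName c c′ c) (swapName c c′ z)  ≡⟨ cong₂ (λ p q → swapName p q (swapName c c′ z))
                                                                               (swap-other (λ a≡c → c≢a (sym a≡c)) (λ a≡c′ → c′≢a (sym a≡c′)))
                                                                               (swap-left c c′) ⟩
          swapName a c′ (swapName c c′ z)                                  ∎)
          where open ≡-Reasoning

  AbsEq-any-fresh : ∀ {a p y q c c′} → c ≢ a → c ≢ p → c #[ X ] y → c #[ X ] q →
                    tr₂ a c · y ≈ₓ tr₂ p c · q →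
                    c′ ≢ a → c′ ≢ p → c′ #[ X ] y → c′ #[ X ] q → tr₂ a c′ · y ≈ₓ tr₂ p c′ · q
  AbsEq-any-fresh {a} {p} {y} {q} {c} {c′} c≢a c≢p c#y c#q same c′≢a c′≢p c′#y c′#q =
    ≈-trans (act-resp (tr₂ a c′) (≈-sym (#-swap c#y c′#y)))
      (≈-trans (swap-past-fresh c≢a c′≢a y)
        (≈-trans (act-resp (tr₂ c c′) same)
          (≈-trans (≈-sym (swap-past-fresh c≢p c′≢p q)) (act-resp (tr₂ p c′) (#-swap c#q c′#q)))))

  AbsEq-functional : ∀ {a y₁ y₂ p q} → AbsEq X a y₁ p q → AbsEq X a y₂ p q → y₁ ≈ₓ y₂
  AbsEq-functional {a} {y₁} {y₂} {p} {q} (c₁ , (c₁≢a , c₁≢p , c₁#y₁ , c₁#q) , same₁)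
                                         (c₂ , (c₂≢a , c₂≢p , c₂#y₂ , c₂#q) , same₂) =
    ≈-trans (≈-sym (swap-swap a c y₁)) (≈-trans (act-resp (tr₂ a c) (≈-trans y₁≈q (≈-sym y₂≈q))) (swap-swap a c y₂))
    where
      L : List 𝔸
      L = a ∷ p ∷ supp y₁ ++ supp y₂ ++ supp q
      c : 𝔸
      c = fresh L
      c∉ : c ∉ supp y₁ ++ supp y₂ ++ supp q
      c∉ = ∉-tail (∉-tail (fresh-∉ L))
      c≢a : c ≢ a
      c≢a = ∉-head (fresh-∉ L)
      c≢p : c ≢ p
      c≢p = ∉-head (∉-tail (fresh-∉ L))
      c#q : c #[ X ] q
      c#q = ∉supp⇒# q (∉-++ʳ (supp y₂) (∉-++ʳ (supp y₁) c∉))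
      y₁≈q : tr₂ a c · y₁ ≈ₓ tr₂ p c · q
      y₁≈q = AbsEq-any-fresh c₁≢a c₁≢p c₁#y₁ c₁#q same₁ c≢a c≢p (∉supp⇒# y₁ (∉-++ˡ (supp y₁) c∉)) c#q
      y₂≈q : tr₂ a c · y₂ ≈ₓ tr₂ p c · q
      y₂≈q = AbsEq-any-fresh c₂≢a c₂≢p c₂#y₂ c₂#q same₂ c≢a c≢p
               (∉supp⇒# y₂ (∉-++ˡ (supp y₂) (∉-++ʳ (supp y₁) c∉))) c#q

  -- Infinitely many fresh b give finitely many classes of (d b)·x, so two of them coincide.
  fixing-swap : ∀ {B : Set} {x} d K (L : List B) (P : Carrier X → B → Set) →
                (∀ {y y′ l} → P y l → P y′ l → y ≈ₓ y′) →
                (∀ b → b ∉ K → Any (P (tr₂ d b · x)) L) →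
                d ∈ K → (∀ t → t ∈ supp x → t ∈ K) →
                ∃ λ b → b ∉ K × tr₂ d b · x ≈ₓ x
  fixing-swap {x = x} d K L P P-functional classify d∈K supp⊆K
    with pigeonhole ≤-refl (λ i → index (classify (freshₙ K (toℕ i)) (freshₙ-∉ K _)))
  ... | i , j , i<j , same-class =
    b i , freshₙ-∉ K _ ,
    swap-coincidence (supp-supports x) (b∉supp i) (b∉supp j) (d≢b i) (d≢b j)
      (λ bi≡bj → <⇒≢ i<j (freshₙ-injective K bi≡bj))
      (P-functional (lookup-index (classify (b i) (freshₙ-∉ K _)))
                    (subst (P (tr₂ d (b j) · x) ∘ lookup L) (sym same-class) (lookup-index (classify (b j) (freshₙ-∉ K _)))))
    where
      b : Fin (suc (length L)) → 𝔸
      b i = freshₙ K (toℕ i)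
      b∉supp : ∀ i → b i ∉ supp x
      b∉supp i t∈ = freshₙ-∉ K _ (supp⊆K _ t∈)
      d≢b : ∀ i → d ≢ b i
      d≢b i d≡ = freshₙ-∉ K _ (subst (_∈ K) d≡ d∈K)

  supports-by-swaps : ∀ {x} S → (∀ d K → d ∉ S → ∃ λ b → b ∉ K × tr₂ d b · x ≈ₓ x) → Supports X S x
  supports-by-swaps {x} S swappable =
    shrink (supp x) (supports-mono (supp-supports x) (λ _ → ∈-++⁺ˡ))
    where
      shrink : ∀ T → Supports X (T ++ S) x → Supports X S x
      shrink []      TS-supports = TS-supports
      shrink (d ∷ T) TS-supports with d ∈? S
      ... | yes d∈S = shrink T (supports-mono TS-supports (λ { _ (here refl) → ∈-++⁺ʳ T d∈S ; _ (there a∈) → a∈ }))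
      ... | no d∉S with swappable d (d ∷ T ++ S) d∉S
      ...   | b , b∉ , db-fixes = shrink T (supports-drop TS-supports b∉ db-fixes)

  supports-by-finite-orbit : ∀ {B : Set} {x} S (L : List B) (P : Carrier X → B → Set) →
                             (∀ {y y′ l} → P y l → P y′ l → y ≈ₓ y′) →
                             (∀ d b → d ∉ S → b ∉ S → Any (P (tr₂ d b · x)) L) →
                             Supports X S x
  supports-by-finite-orbit {x = x} S L P P-functional classify = supports-by-swaps S swappable
    where
      swappable : ∀ d K → d ∉ S → ∃ λ b → b ∉ K × tr₂ d b · x ≈ₓ x
      swappable d K d∉S =
        map₂ (map₁ (λ b∉ → ∉-++ˡ K (∉-tail b∉)))
             (fixing-swap d (d ∷ K ++ supp x ++ S) L P P-functional
                (λ b b∉ → classify d b d∉S (∉-++ʳ (supp x) (∉-++ʳ K (∉-tail b∉))))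
                (here refl) (λ _ t∈ → there (∈-++⁺ʳ K (∈-++⁺ˡ t∈))))

module Automaton (A : RNNA) where
  open Nominal (Q A) (Q-nom A)
  open IsNominal (Q-nom A) using (isEquiv; act-id)
  open IsEquivalence isEquiv renaming (refl to ≈-refl; sym to ≈-sym; trans to ≈-trans)

  State : Set
  State = Carrier (Q A)

  R-fixing : ∀ {S q σ q′} → Supports (Q A) S q → ∀ π → (∀ a → a ∈ S → perm π a ≡ a) →
             R A q σ q′ → R A q (actLetter π σ) (π · q′)
  R-fixing S-supports π fix r = R-resp A (S-supports π fix) ≈-refl (R-equiv A π _ _ _ r)

  plain-label∈support : ∀ {S q a q′} → Supports (Q A) S q → R A q (plain a) q′ → a ∈ S
  -- Otherwise renaming a to any fresh b yields infinitely many free labels at q.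
  plain-label∈support {S} {q} {a} {q′} S-supports r with a ∈? S
  ... | yes a∈S = a∈S
  ... | no a∉S  = contradiction b∈labels (∉-++ʳ S (∉-tail (fresh-∉ K)))
    where
      labels : List 𝔸
      labels = map proj₁ (proj₁ (finFree A q))
      K : List 𝔸
      K = a ∷ S ++ labels
      b : 𝔸
      b = fresh K
      r′ : R A q (plain b) (tr₂ a b · q′)
      r′ = subst (λ x → R A q (plain x) (tr₂ a b · q′)) (swap-left a b)
             (R-fixing S-supports (tr₂ a b) (swap-fixes S a∉S (∉-++ˡ S (∉-tail (fresh-∉ K)))) r)
      b∈labels : b ∈ labels
      b∈labels with find (proj₂ (proj₂ (finFree A q)) b _ r′)
      ... | (a′ , q″) , p∈ , (b≡a′ , _) = subst (_∈ labels) (sym b≡a′) (∈-map⁺ proj₁ p∈)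

  plain-successor-supports : ∀ {S q a q′} → Supports (Q A) S q → R A q (plain a) q′ → Supports (Q A) S q′
  plain-successor-supports {S} {q} {a} {q′} S-supports r =
    supports-by-finite-orbit S (proj₁ (finFree A q)) P
      (λ (_ , y≈) (_ , y′≈) → ≈-trans y≈ (≈-sym y′≈)) classify
    where
      P : State → 𝔸 × State → Set
      P y (a′ , q″) = FEq (Q A) (pl a y) (pl a′ q″)
      classify : ∀ d b → d ∉ S → b ∉ S → Any (P (tr₂ d b · q′)) (proj₁ (finFree A q))
      classify d b d∉S b∉S = proj₂ (proj₂ (finFree A q)) a _
        (subst (λ x → R A q (plain x) (tr₂ d b · q′)) (swap-fixes S d∉S b∉S a (plain-label∈support S-supports r))
               (R-fixing S-supports (tr₂ d b) (swap-fixes S d∉S b∉S) r))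

  bar-successor-supports : ∀ {S q a q′} → Supports (Q A) S q → R A q (bar a) q′ → Supports (Q A) (a ∷ S) q′
  bar-successor-supports {S} {q} {a} {q′} S-supports r =
    supports-by-finite-orbit (a ∷ S) (proj₁ (finBound A q)) P AbsEq-functional classify
    where
      P : State → 𝔸 × State → Set
      P y (a′ , q″) = AbsEq (Q A) a y a′ q″
      classify : ∀ d b → d ∉ a ∷ S → b ∉ a ∷ S → Any (P (tr₂ d b · q′)) (proj₁ (finBound A q))
      classify d b d∉ b∉ = proj₂ (proj₂ (finBound A q)) a _
        (subst (λ x → R A q (bar x) (tr₂ d b · q′)) (swap-fixes (a ∷ S) d∉ b∉ a (here refl))
               (R-fixing S-supports (tr₂ d b) (swap-fixes S (∉-tail d∉) (∉-tail b∉)) r))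

  accepts⇒free⊆support : ∀ {S q w} → Supports (Q A) S q → Accepts A q w → ∀ d → free d ∈ nameless [] w → d ∈ S
  accepts⇒free⊆support S-supports (done _) d ()
  accepts⇒free⊆support S-supports (step {σ = plain a} r acc) d (here refl) = plain-label∈support S-supports r
  accepts⇒free⊆support S-supports (step {σ = plain a} r acc) d (there d∈) =
    accepts⇒free⊆support (plain-successor-supports S-supports r) acc d d∈
  accepts⇒free⊆support S-supports (step {σ = bar a} {w = w} r acc) d (there d∈) =
    ∈-tail (∉-head (proj₂ (free∈nameless (a ∷ []) w d∈)))
           (accepts⇒free⊆support (bar-successor-supports S-supports r) acc d (free∈nameless-++ [] (a ∷ []) w d∈))

  accepts-resp-≈ : ∀ {q q′ w} → q ≈ₓ q′ → Accepts A q w → Accepts A q′ w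
  accepts-resp-≈ q≈q′ (done f)     = done (F-resp A q≈q′ f)
  accepts-resp-≈ q≈q′ (step r acc) = step (R-resp A q≈q′ ≈-refl r) acc

  accepts-act : ∀ π {q w} → Accepts A q w → Accepts A (π · q) (actBS π w)
  accepts-act π (done f)     = done (F-equiv A π _ f)
  accepts-act π (step r acc) = step (R-equiv A π _ _ _ r) (accepts-act π acc)

  trace : QMap A
  trace = InBarLang A

  trace-equivariant : ∀ π q v → trace (π · q) v ⇔ (∃ λ w → trace q w × v =α actBS π w)
  trace-equivariant π q v = mk⇔
    (λ (u , acc , u=v) → actBS (inverse π) u ,
       (actBS (inverse π) u , accepts-resp-≈ π⁻¹πq≈q (accepts-act (inverse π) acc) , α-refl) ,
       α-sym (subst (_=α v) (sym (actBS-inverseʳ π u)) u=v))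
    (λ (w , (u , acc , u=w) , v=πw) → actBS π u , accepts-act π acc , α-trans (actBS-resp-=α π u=w) (α-sym v=πw))
    where
      π⁻¹πq≈q : inverse π · π · q ≈ₓ q
      π⁻¹πq≈q = ≈-trans (act-∘ (inverse π) π [] q (perm-inverseˡ π)) (act-id q)

  trace-isEquivUfsMap : IsEquivUfsMap A trace
  trace-isEquivUfsMap = record
    { resp-α = λ q v=w (u , acc , u=v) → u , acc , α-trans u=v v=w
    ; resp-Q = λ q≈q′ v (w , acc , w=v) → w , accepts-resp-≈ q≈q′ acc , w=v
    ; ufs    = λ q → supp q , λ v (w , acc , w=v) → free-names-supports v (λ d d∈v →
                 accepts⇒free⊆support (supp-supports q) acc d (subst (free d ∈_) (sym (=α⇒nameless≡ w=v [])) d∈v))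
    ; equiv  = trace-equivariant
    }

  Jι⁻¹⇔ : ∀ v z → Jι⁻¹ A v z ⇔ ι z =α v
  Jι⁻¹⇔ []            z = FEq-BarLang⇔ z star
  Jι⁻¹⇔ (plain a ∷ v) z = FEq-BarLang⇔ z (pl a v)
  Jι⁻¹⇔ (bar a ∷ v)   z = FEq-BarLang⇔ z (ab a v)

  lhsComp⇔ : ∀ t → (∀ q {v w} → v =α w → t q v → t q w) → ∀ q z → lhsComp A t q z ⇔ t q (ι z)
  lhsComp⇔ t t-resp-α q z = mk⇔
    (λ (v , tv , J) → t-resp-α q (α-sym (to (Jι⁻¹⇔ v z) J)) tv)
    (λ tz → ι z , tz , from (Jι⁻¹⇔ (ι z) z) α-refl)

  trace-unfold : ∀ q z → trace q (ι z) → rhsComp A trace q z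
  trace-unfold q z (_ , done f , []=z) = star , f , from (FEq-BarLang⇔ z star) (α-sym []=z)
  trace-unfold q z (_ , step {σ = plain a} {q′} {w} r acc , aw=z) =
    pl a q′ , r , w , (w , acc , α-refl) , from (FEq-BarLang⇔ z (pl a w)) (α-sym aw=z)
  trace-unfold q z (_ , step {σ = bar a} {q′} {w} r acc , aw=z) =
    ab a q′ , r , w , (w , acc , α-refl) , from (FEq-BarLang⇔ z (ab a w)) (α-sym aw=z)

  trace-fold : ∀ q z → rhsComp A trace q z → trace q (ι z)
  trace-fold q z (star , f , z≈) = [] , done f , α-sym (to (FEq-BarLang⇔ z star) z≈)
  trace-fold q z (pl a q′ , r , v , (w , acc , w=v) , z≈) =
    plain a ∷ w , step r acc , α-trans (∷-resp-=α (plain a) w=v) (α-sym (to (FEq-BarLang⇔ z (pl a v)) z≈))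
  trace-fold q z (ab a q′ , r , v , (w , acc , w=v) , z≈) =
    bar a ∷ w , step r acc , α-trans (∷-resp-=α (bar a) w=v) (α-sym (to (FEq-BarLang⇔ z (ab a v)) z≈))

  trace-TraceEq : TraceEq A trace
  trace-TraceEq q z = mk⇔
    (trace-unfold q z ∘ to (lhsComp⇔ trace resp-α q z))
    (from (lhsComp⇔ trace resp-α q z) ∘ trace-fold q z)
    where open IsEquivUfsMap trace-isEquivUfsMap using (resp-α)

  module _ (t : QMap A) (t-resp-α : ∀ q {v w} → v =α w → t q v → t q w) (t-trace : TraceEq A t) where

    private
      t-fold : ∀ q z → rhsComp A t q z → t q (ι z)
      t-fold q z = to (lhsComp⇔ t t-resp-α q z) ∘ from (t-trace q z)

      t-unfold : ∀ q z → t q (ι z) → rhsComp A t q z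
      t-unfold q z = to (t-trace q z) ∘ from (lhsComp⇔ t t-resp-α q z)

    accepts⇒trace-solution : ∀ {q w} → Accepts A q w → t q w
    accepts⇒trace-solution (done f) = t-fold _ star (star , f , tt)
    accepts⇒trace-solution (step {σ = plain a} {w = w} r acc) =
      t-fold _ (pl a w) (pl a _ , r , w , accepts⇒trace-solution acc , refl , α-refl)
    accepts⇒trace-solution (step {σ = bar a} {w = w} r acc) =
      t-fold _ (ab a w) (ab a _ , r , w , accepts⇒trace-solution acc ,
                         from (FEq-BarLang⇔ (ab a w) (ab a w)) α-refl)

    -- Induction on the length: the word read off from t-unfold is only α-equivalent to the tail.
    trace-solution⇒accepts : ∀ n q v → length v ≡ n → t q v → trace q v
    trace-solution⇒accepts n q [] _ tv = from-star (t-unfold q star tv)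
      where
        from-star : rhsComp A t q star → trace q []
        from-star (star , f , _) = [] , done f , α-refl
    trace-solution⇒accepts (suc n) q (plain a ∷ v) len tv = from-plain (t-unfold q (pl a v) tv)
      where
        from-plain : rhsComp A t q (pl a v) → trace q (plain a ∷ v)
        from-plain (pl _ q′ , r , u , tu , refl , v=u) =
          let w , acc , w=u = trace-solution⇒accepts n q′ u (trans (sym (=α-length v=u)) (suc-injective len)) tu
          in  plain a ∷ w , step r acc , ∷-resp-=α (plain a) (α-trans w=u (α-sym v=u))
    trace-solution⇒accepts (suc n) q (bar a ∷ v) len tv = from-bar (t-unfold q (ab a v) tv)
      where
        from-bar : rhsComp A t q (ab a v) → trace q (bar a ∷ v)
        from-bar (ab b q′ , r , u , tu , av≈bu) =
          let av=bu = to AbsEq-BarLang⇔=α av≈bu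
              w , acc , w=u = trace-solution⇒accepts n q′ u (suc-injective (trans (sym (=α-length av=bu)) len)) tu
          in  bar b ∷ w , step r acc , α-trans (∷-resp-=α (bar b) w=u) (α-sym av=bu)

  trace-unique : ∀ t → IsEquivUfsMap A t → TraceEq A t → _≗ₚ_ A t trace
  trace-unique t t-isEquiv t-trace q v = mk⇔
    (trace-solution⇒accepts t resp-α t-trace _ q v refl)
    (λ (w , acc , w=v) → resp-α q w=v (accepts⇒trace-solution t resp-α t-trace acc))
    where open IsEquivUfsMap t-isEquiv using (resp-α)

mainTheorem15 : (A : RNNA) →
    Σ (QMap A) λ tr →
      (IsEquivUfsMap A tr × TraceEq A tr) ×
      (∀ (t : QMap A) → IsEquivUfsMap A t → TraceEq A t → _≗ₚ_ A t tr) ×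
      (∀ q v → tr q v ⇔ InBarLang A q v)
mainTheorem15 A =
  trace , (trace-isEquivUfsMap , trace-TraceEq) , trace-unique , λ q v → mk⇔ id id
  where open Automaton A
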